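{- $\mathbf{MEA}$ is closed under each of the rules $\mathsf{HMR_{Nt}}$, $\mathsf{HMR_{W1}}$, $\mathsf{HMR_{W2}}$ and $\mathsf{HMR_{W3}}$; that is, for every $R(x,y)$ of the form $f(x,y)=0$ with $f$ a binary primitive recursive function symbol: (Nt) if $\vdash_{\mathbf{MEA}}\Diamond P\forall x\neg\Diamond P\neg\exists yR(x,y)$ then $\vdash_{\mathbf{MEA}}\Diamond P\forall x\exists yR(x,y)$; (W1) if $\vdash_{\mathbf{MEA}}\Diamond\forall x\Diamond P\exists yR(x,y)$ then $\vdash_{\mathbf{MEA}}\Diamond P\forall x\exists yR(x,y)$; (W2) if $\vdash_{\mathbf{MEA}}\Box\forall x\neg\Diamond P\neg\exists yR(x,y)$ then $\vdash_{\mathbf{MEA}}\Box\forall x\exists yR(x,y)$; (W3) if $\vdash_{\mathbf{MEA}}\Box\forall x\Diamond\exists yR(x,y)$ then $\vdash_{\mathbf{MEA}}\Box\forall x\exists yR(x,y)$.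
   Context: Horsten's modal-epistemic arithmetic $\mathbf{MEA}$ has the language of Peano arithmetic (assumed to include a function symbol for each primitive recursive function) extended by two primitive unary operators $\Box$ and $P$; $\neg A:=A\supset\bot$ and $\Diamond A:=\neg\Box\neg A$. It is given by a Hilbert-style classical first-order calculus with equality, the axioms of Peano arithmetic (induction for all formulas of the extended language), and: M*1 $\Box A\supset A$; M*2 $(\Box A\wedge\Box(A\supset B))\supset\Box B$; M*3 from $A$ infer $\Box A$; M*4 $\Diamond A\supset\Box\Diamond A$; M*5 $\Diamond A\supset A$ for $A$ containing neither $\Box$ nor $P$; M*6 $\Diamond\exists xA\supset\exists x\Diamond A$; E*1 $PA\supset A$; E*2 $PA\supset PPA$; ME*1 from $A$ infer $\Diamond PA$; ME*2 $(\Diamond PA\wedge\Diamond P(A\supset B))\supset\Diamond PB$. -}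

module Defs where

open import Data.Nat using (ℕ; zero; suc)
open import Data.Fin using (Fin)
open import Data.Vec using (Vec; []; _∷_; lookup; map)
open import Data.Unit using (⊤)
open import Data.Product using (_×_)

infixr 5 _⊃_
infix 7 _≐_
infix 3 ⊢_

data PR : ℕ → Set where
  Zr   : PR 0
  Sc   : PR 1
  proj : ∀ {n} → Fin n → PR n
  comp : ∀ {m n} → PR m → Vec (PR n) m → PR n
  rec  : ∀ {n} → PR n → PR (suc (suc n)) → PR (suc n)

data Term : Set where
  var : ℕ → Term
  app : ∀ {n} → PR n → Vec Term n → Term

𝟎 : Term
𝟎 = app Zr []

S : Term → Term
S t = app Sc (t ∷ [])

data Fm : Set where
  ⊥'  : Fm
  _≐_ : Term → Term → Fm
  _⊃_ : Fm → Fm → Fm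
  ∀'  : Fm → Fm          -- binds de Bruijn variable 0
  □   : Fm → Fm
  P   : Fm → Fm

¬' : Fm → Fm
¬' A = A ⊃ ⊥'

◇ : Fm → Fm
◇ A = ¬' (□ (¬' A))

∃' : Fm → Fm
∃' A = ¬' (∀' (¬' A))

_∧'_ : Fm → Fm → Fm
A ∧' B = ¬' (A ⊃ ¬' B)

ModalFree : Fm → Set
ModalFree ⊥'      = ⊤
ModalFree (_ ≐ _) = ⊤
ModalFree (A ⊃ B) = ModalFree A × ModalFree B
ModalFree (∀' A)  = ModalFree A
ModalFree (□ _)   = Data.Empty.⊥ where import Data.Empty
ModalFree (P _)   = Data.Empty.⊥ where import Data.Empty

Sub : Set
Sub = ℕ → Term

mutual
  substT : Sub → Term → Term
  substT σ (var i)    = σ i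
  substT σ (app f ts) = app f (substTs σ ts)

  substTs : ∀ {n} → Sub → Vec Term n → Vec Term n
  substTs σ []       = []
  substTs σ (t ∷ ts) = substT σ t ∷ substTs σ ts

shiftT : Term → Term
shiftT = substT (λ i → var (suc i))

lift : Sub → Sub
lift σ zero    = var zero
lift σ (suc i) = shiftT (σ i)

substF : Sub → Fm → Fm
substF σ ⊥'      = ⊥'
substF σ (s ≐ t) = substT σ s ≐ substT σ t
substF σ (A ⊃ B) = substF σ A ⊃ substF σ B
substF σ (∀' A)  = ∀' (substF (lift σ) A)
substF σ (□ A)   = □ (substF σ A)
substF σ (P A)   = P (substF σ A)

wk : Fm → Fm
wk = substF (λ i → var (suc i))

-- A[t/x0], other free variables shifted down
single : Term → Sub
single t zero    = t
single t (suc i) = var i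

_[_] : Fm → Term → Fm
A [ t ] = substF (single t) A

succSub : Sub
succSub zero    = S (var zero)
succSub (suc i) = var (suc i)

-- The Hilbert-style system MEA (theorems may contain free variables).

data ⊢_ : Fm → Set where
  ax-K   : ∀ A B → ⊢ A ⊃ B ⊃ A
  ax-S   : ∀ A B C → ⊢ (A ⊃ B ⊃ C) ⊃ (A ⊃ B) ⊃ A ⊃ C
  ax-DN  : ∀ A → ⊢ ¬' (¬' A) ⊃ A
  mp     : ∀ {A B} → ⊢ A ⊃ B → ⊢ A → ⊢ B
  ax-∀E  : ∀ A t → ⊢ ∀' A ⊃ A [ t ]
  ax-∀⊃  : ∀ A B → ⊢ ∀' (wk A ⊃ B) ⊃ A ⊃ ∀' B
  gen    : ∀ {A} → ⊢ A → ⊢ ∀' A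
  ax-refl : ∀ t → ⊢ t ≐ t
  ax-leib : ∀ A s t → ⊢ s ≐ t ⊃ A [ s ] ⊃ A [ t ]
  pa-S≠0  : ∀ t → ⊢ ¬' (S t ≐ 𝟎)
  pa-Sinj : ∀ s t → ⊢ S s ≐ S t ⊃ s ≐ t
  pa-proj : ∀ {n} (i : Fin n) (ts : Vec Term n) → ⊢ app (proj i) ts ≐ lookup ts i
  pa-comp : ∀ {m n} (f : PR m) (gs : Vec (PR n) m) (ts : Vec Term n) →
            ⊢ app (comp f gs) ts ≐ app f (map (λ g → app g ts) gs)
  pa-rec0 : ∀ {n} (f : PR n) (g : PR (suc (suc n))) (ts : Vec Term n) →
            ⊢ app (rec f g) (𝟎 ∷ ts) ≐ app f ts
  pa-recS : ∀ {n} (f : PR n) (g : PR (suc (suc n))) (t : Term) (ts : Vec Term n) →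
            ⊢ app (rec f g) (S t ∷ ts) ≐ app g (t ∷ app (rec f g) (t ∷ ts) ∷ ts)
  pa-ind  : ∀ A → ⊢ A [ 𝟎 ] ⊃ ∀' (A ⊃ substF succSub A) ⊃ ∀' A
  M1  : ∀ A → ⊢ □ A ⊃ A
  M2  : ∀ A B → ⊢ (□ A ∧' □ (A ⊃ B)) ⊃ □ B
  M3  : ∀ {A} → ⊢ A → ⊢ □ A
  M4  : ∀ A → ⊢ ◇ A ⊃ □ (◇ A)
  M5  : ∀ A → ModalFree A → ⊢ ◇ A ⊃ A
  M6  : ∀ A → ⊢ ◇ (∃' A) ⊃ ∃' (◇ A)
  E1  : ∀ A → ⊢ P A ⊃ A
  E2  : ∀ A → ⊢ P A ⊃ P (P A)
  ME1 : ∀ {A} → ⊢ A → ⊢ ◇ (P A)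
  ME2 : ∀ A B → ⊢ (◇ (P A) ∧' ◇ (P (A ⊃ B))) ⊃ ◇ (P B)

-- R(x,y) :≡ f(x,y) = 0, inside ∀x ∃y (x = var 1, y = var 0).

R : PR 2 → Fm
R f = app f (var 1 ∷ var 0 ∷ []) ≐ 𝟎

{-# OPTIONS --safe #-}
-- Reading P as □ is a sound interpretation of MEA in itself: E1 and E2 become
-- the T and 4 axioms for □, and ME1, ME2 follow from ◇□A ⊃ □A, which holds
-- since □ is S5.  Under this reading the premise of each rule yields a theorem
-- in which ¬◇P¬A and ◇PA become ¬◇□¬A and ◇□A, both of which imply ◇A; for an
-- arithmetical A, M5 turns ◇A into A.  Hence ⊢ ∀xA, and the conclusions
-- follow by necessitation and ME1.
module Submission where

open import Defs
open import Data.Nat using (zero; suc)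
open import Data.Vec using (Vec; []; _∷_)
open import Data.List using (List; []; _∷_)
open import Data.List.Membership.Propositional using (_∈_)
open import Data.List.Relation.Unary.Any using (here; there)
open import Data.Product using (_×_; _,_)
open import Data.Unit using (tt)
open import Relation.Binary.PropositionalEquality
  using (_≡_; _≗_; refl; sym; trans; cong; cong₂; subst)

↑ : Sub
↑ i = var (suc i)

_⊙_ : Sub → Sub → Sub
(σ ⊙ ρ) i = substT σ (ρ i)

mutual
  substT-cong : ∀ {σ ρ} → σ ≗ ρ → ∀ t → substT σ t ≡ substT ρ t
  substT-cong σ≗ρ (var i)    = σ≗ρ i
  substT-cong σ≗ρ (app f ts) = cong (app f) (substTs-cong σ≗ρ ts)

  substTs-cong : ∀ {n σ ρ} → σ ≗ ρ → (ts : Vec Term n) → substTs σ ts ≡ substTs ρ ts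
  substTs-cong σ≗ρ []       = refl
  substTs-cong σ≗ρ (t ∷ ts) = cong₂ _∷_ (substT-cong σ≗ρ t) (substTs-cong σ≗ρ ts)

mutual
  substT-⊙ : ∀ σ ρ t → substT σ (substT ρ t) ≡ substT (σ ⊙ ρ) t
  substT-⊙ σ ρ (var i)    = refl
  substT-⊙ σ ρ (app f ts) = cong (app f) (substTs-⊙ σ ρ ts)

  substTs-⊙ : ∀ {n} σ ρ (ts : Vec Term n) → substTs σ (substTs ρ ts) ≡ substTs (σ ⊙ ρ) ts
  substTs-⊙ σ ρ []       = refl
  substTs-⊙ σ ρ (t ∷ ts) = cong₂ _∷_ (substT-⊙ σ ρ t) (substTs-⊙ σ ρ ts)

lift-cong : ∀ {σ ρ} → σ ≗ ρ → lift σ ≗ lift ρ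
lift-cong σ≗ρ zero    = refl
lift-cong σ≗ρ (suc i) = cong shiftT (σ≗ρ i)

-- Both sides equal substT (shiftT ∘ σ) (ρ i).
lift-⊙ : ∀ σ ρ → lift σ ⊙ lift ρ ≗ lift (σ ⊙ ρ)
lift-⊙ σ ρ zero    = refl
lift-⊙ σ ρ (suc i) = trans (substT-⊙ (lift σ) ↑ (ρ i)) (sym (substT-⊙ ↑ σ (ρ i)))

substF-cong : ∀ {σ ρ} → σ ≗ ρ → ∀ A → substF σ A ≡ substF ρ A
substF-cong σ≗ρ ⊥'      = refl
substF-cong σ≗ρ (s ≐ t) = cong₂ _≐_ (substT-cong σ≗ρ s) (substT-cong σ≗ρ t)
substF-cong σ≗ρ (A ⊃ B) = cong₂ _⊃_ (substF-cong σ≗ρ A) (substF-cong σ≗ρ B)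
substF-cong σ≗ρ (∀' A)  = cong ∀' (substF-cong (lift-cong σ≗ρ) A)
substF-cong σ≗ρ (□ A)   = cong □ (substF-cong σ≗ρ A)
substF-cong σ≗ρ (P A)   = cong P (substF-cong σ≗ρ A)

substF-⊙ : ∀ σ ρ A → substF σ (substF ρ A) ≡ substF (σ ⊙ ρ) A
substF-⊙ σ ρ ⊥'      = refl
substF-⊙ σ ρ (s ≐ t) = cong₂ _≐_ (substT-⊙ σ ρ s) (substT-⊙ σ ρ t)
substF-⊙ σ ρ (A ⊃ B) = cong₂ _⊃_ (substF-⊙ σ ρ A) (substF-⊙ σ ρ B)
substF-⊙ σ ρ (∀' A)  =
  cong ∀' (trans (substF-⊙ (lift σ) (lift ρ) A) (substF-cong (lift-⊙ σ ρ) A))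
substF-⊙ σ ρ (□ A)   = cong □ (substF-⊙ σ ρ A)
substF-⊙ σ ρ (P A)   = cong P (substF-⊙ σ ρ A)

mutual
  substT-var : ∀ t → substT var t ≡ t
  substT-var (var i)    = refl
  substT-var (app f ts) = cong (app f) (substTs-var ts)

  substTs-var : ∀ {n} (ts : Vec Term n) → substTs var ts ≡ ts
  substTs-var []       = refl
  substTs-var (t ∷ ts) = cong₂ _∷_ (substT-var t) (substTs-var ts)

lift-var : lift var ≗ var
lift-var zero    = refl
lift-var (suc i) = refl

substF-var : ∀ A → substF var A ≡ A
substF-var ⊥'      = refl
substF-var (s ≐ t) = cong₂ _≐_ (substT-var s) (substT-var t)
substF-var (A ⊃ B) = cong₂ _⊃_ (substF-var A) (substF-var B)
substF-var (∀' A)  = cong ∀' (trans (substF-cong lift-var A) (substF-var A))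
substF-var (□ A)   = cong □ (substF-var A)
substF-var (P A)   = cong P (substF-var A)

wk-lift-[var₀] : ∀ A → substF (lift ↑) A [ var zero ] ≡ A
wk-lift-[var₀] A = trans (substF-⊙ (single (var zero)) (lift ↑) A)
                         (trans (substF-cong single-lift-↑ A) (substF-var A))
  where
  single-lift-↑ : single (var zero) ⊙ lift ↑ ≗ var
  single-lift-↑ zero    = refl
  single-lift-↑ (suc i) = refl

infix  3 _⊢ₕ_
infixl 9 _·_

data _⊢ₕ_ (Γ : List Fm) : Fm → Set where
  hyp : ∀ {A} → A ∈ Γ → Γ ⊢ₕ A
  thm : ∀ {A} → ⊢ A → Γ ⊢ₕ A
  _·_ : ∀ {A B} → Γ ⊢ₕ A ⊃ B → Γ ⊢ₕ A → Γ ⊢ₕ B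

hyp₀ : ∀ {Γ A} → A ∷ Γ ⊢ₕ A
hyp₀ = hyp (here refl)

hyp₁ : ∀ {Γ A B} → B ∷ A ∷ Γ ⊢ₕ A
hyp₁ = hyp (there (here refl))

hyp₂ : ∀ {Γ A B C} → C ∷ B ∷ A ∷ Γ ⊢ₕ A
hyp₂ = hyp (there (there (here refl)))

⊃-refl : ∀ A → ⊢ A ⊃ A
⊃-refl A = mp (mp (ax-S A (A ⊃ A) A) (ax-K A (A ⊃ A))) (ax-K A A)

deduction : ∀ {Γ A B} → A ∷ Γ ⊢ₕ B → Γ ⊢ₕ A ⊃ B
deduction {A = A} (hyp (here refl)) = thm (⊃-refl A)
deduction (hyp (there i))           = thm (ax-K _ _) · hyp i
deduction (thm d)                   = thm (ax-K _ _) · thm d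
deduction (d · e)                   = thm (ax-S _ _ _) · deduction d · deduction e

closed : ∀ {A} → [] ⊢ₕ A → ⊢ A
closed (thm d) = d
closed (d · e) = mp (closed d) (closed e)

⊃-trans : ∀ {A B C} → ⊢ A ⊃ B → ⊢ B ⊃ C → ⊢ A ⊃ C
⊃-trans ab bc = closed (deduction (thm bc · (thm ab · hyp₀)))

⊥'-elim : ∀ A → ⊢ ⊥' ⊃ A
⊥'-elim A = closed (deduction (thm (ax-DN A) · deduction hyp₁))

¬¬-intro : ∀ A → ⊢ A ⊃ ¬' (¬' A)
¬¬-intro A = closed (deduction (deduction (hyp₀ · hyp₁)))

∧-intro : ∀ A B → ⊢ A ⊃ B ⊃ A ∧' B
∧-intro A B = closed (deduction (deduction (deduction (hyp₀ · hyp₂ · hyp₁))))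

∧-elim₁ : ∀ A B → ⊢ A ∧' B ⊃ A
∧-elim₁ A B = closed (deduction (thm (ax-DN A) ·
  deduction (hyp₁ · deduction (thm (⊥'-elim (¬' B)) · (hyp₁ · hyp₀)))))

∧-elim₂ : ∀ A B → ⊢ A ∧' B ⊃ B
∧-elim₂ A B = closed (deduction (thm (ax-DN B) · deduction (hyp₁ · deduction hyp₁)))

∀-mono : ∀ {A B} → ⊢ A ⊃ B → ⊢ ∀' A ⊃ ∀' B
∀-mono {A} {B} ab = mp (ax-∀⊃ (∀' A) B) (gen (⊃-trans ∀-elim-wk ab))
  where
  ∀-elim-wk : ⊢ wk (∀' A) ⊃ A
  ∀-elim-wk = subst (λ X → ⊢ wk (∀' A) ⊃ X) (wk-lift-[var₀] A)
                    (ax-∀E (substF (lift ↑) A) (var zero))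

□-mono : ∀ {A B} → ⊢ A ⊃ B → ⊢ □ A ⊃ □ B
□-mono {A} {B} ab = closed (deduction
  (thm (M2 A B) · (thm (∧-intro (□ A) (□ (A ⊃ B))) · hyp₀ · thm (M3 ab))))

◇-intro : ∀ A → ⊢ A ⊃ ◇ A
◇-intro A = closed (deduction (deduction (thm (M1 (¬' A)) · hyp₀ · hyp₁)))

◇-mono : ∀ {A B} → ⊢ A ⊃ B → ⊢ ◇ A ⊃ ◇ B
◇-mono {A} {B} ab = closed (deduction (deduction (hyp₁ · (thm (□-mono ¬B⊃¬A) · hyp₀))))
  where
  ¬B⊃¬A : ⊢ ¬' B ⊃ ¬' A
  ¬B⊃¬A = closed (deduction (deduction (hyp₁ · (thm ab · hyp₀))))

-- ¬□A gives ◇¬A, which M4 makes necessary: □¬□A, contradicting ◇□A.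
◇□⊃□ : ∀ A → ⊢ ◇ (□ A) ⊃ □ A
◇□⊃□ A = closed (deduction (thm (ax-DN (□ A)) ·
  deduction (hyp₁ · (thm (□-mono ◇¬⊃¬□) · (thm (M4 (¬' A)) · (thm ¬□⊃◇¬ · hyp₀))))))
  where
  ¬□⊃◇¬ : ⊢ ¬' (□ A) ⊃ ◇ (¬' A)
  ¬□⊃◇¬ = closed (deduction (deduction (hyp₁ · (thm (□-mono (ax-DN A)) · hyp₀))))

  ◇¬⊃¬□ : ⊢ ◇ (¬' A) ⊃ ¬' (□ A)
  ◇¬⊃¬□ = closed (deduction (deduction (hyp₁ · (thm (□-mono (¬¬-intro A)) · hyp₀))))

□⊃□□ : ∀ A → ⊢ □ A ⊃ □ (□ A)
□⊃□□ A = closed (deduction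
  (thm (□-mono (◇□⊃□ A)) · (thm (M4 (□ A)) · (thm (◇-intro (□ A)) · hyp₀))))

¬◇□¬⊃◇ : ∀ A → ⊢ ¬' (◇ (□ (¬' A))) ⊃ ◇ A
¬◇□¬⊃◇ A = closed (deduction (deduction (hyp₁ · (thm (◇-intro (□ (¬' A))) · hyp₀))))

◇□-mp : ∀ A B → ⊢ ◇ (□ A) ∧' ◇ (□ (A ⊃ B)) ⊃ ◇ (□ B)
◇□-mp A B = closed (deduction (thm (◇-intro (□ B)) · (thm (M2 A B) ·
  (thm (∧-intro (□ A) (□ (A ⊃ B)))
    · (thm (◇□⊃□ A) · (thm (∧-elim₁ (◇ (□ A)) (◇ (□ (A ⊃ B)))) · hyp₀))
    · (thm (◇□⊃□ (A ⊃ B)) · (thm (∧-elim₂ (◇ (□ A)) (◇ (□ (A ⊃ B)))) · hyp₀))))))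

collapse : Fm → Fm
collapse ⊥'      = ⊥'
collapse (s ≐ t) = s ≐ t
collapse (A ⊃ B) = collapse A ⊃ collapse B
collapse (∀' A)  = ∀' (collapse A)
collapse (□ A)   = □ (collapse A)
collapse (P A)   = □ (collapse A)

collapse-substF : ∀ σ A → collapse (substF σ A) ≡ substF σ (collapse A)
collapse-substF σ ⊥'      = refl
collapse-substF σ (s ≐ t) = refl
collapse-substF σ (A ⊃ B) = cong₂ _⊃_ (collapse-substF σ A) (collapse-substF σ B)
collapse-substF σ (∀' A)  = cong ∀' (collapse-substF (lift σ) A)
collapse-substF σ (□ A)   = cong □ (collapse-substF σ A)
collapse-substF σ (P A)   = cong □ (collapse-substF σ A)

collapse-modalFree : ∀ {A} → ModalFree A → collapse A ≡ A
collapse-modalFree {⊥'}    _         = refl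
collapse-modalFree {s ≐ t} _         = refl
collapse-modalFree {A ⊃ B} (mA , mB) = cong₂ _⊃_ (collapse-modalFree mA) (collapse-modalFree mB)
collapse-modalFree {∀' A}  mA        = cong ∀' (collapse-modalFree mA)

collapse-sound : ∀ {A} → ⊢ A → ⊢ collapse A
collapse-sound (ax-K A B)   = ax-K (collapse A) (collapse B)
collapse-sound (ax-S A B C) = ax-S (collapse A) (collapse B) (collapse C)
collapse-sound (ax-DN A)    = ax-DN (collapse A)
collapse-sound (mp d e)     = mp (collapse-sound d) (collapse-sound e)
collapse-sound (ax-∀E A t)
  rewrite collapse-substF (single t) A = ax-∀E (collapse A) t
collapse-sound (ax-∀⊃ A B)
  rewrite collapse-substF ↑ A = ax-∀⊃ (collapse A) (collapse B)
collapse-sound (gen d)      = gen (collapse-sound d)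
collapse-sound (ax-refl t)  = ax-refl t
collapse-sound (ax-leib A s t)
  rewrite collapse-substF (single s) A | collapse-substF (single t) A = ax-leib (collapse A) s t
collapse-sound (pa-S≠0 t)          = pa-S≠0 t
collapse-sound (pa-Sinj s t)       = pa-Sinj s t
collapse-sound (pa-proj i ts)      = pa-proj i ts
collapse-sound (pa-comp f gs ts)   = pa-comp f gs ts
collapse-sound (pa-rec0 f g ts)    = pa-rec0 f g ts
collapse-sound (pa-recS f g t ts)  = pa-recS f g t ts
collapse-sound (pa-ind A)
  rewrite collapse-substF (single 𝟎) A | collapse-substF succSub A = pa-ind (collapse A)
collapse-sound (M1 A)       = M1 (collapse A)
collapse-sound (M2 A B)     = M2 (collapse A) (collapse B)
collapse-sound (M3 d)       = M3 (collapse-sound d)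
collapse-sound (M4 A)       = M4 (collapse A)
collapse-sound (M5 A mA)
  rewrite collapse-modalFree {A} mA = M5 A mA
collapse-sound (M6 A)       = M6 (collapse A)
collapse-sound (E1 A)       = M1 (collapse A)
collapse-sound (E2 A)       = □⊃□□ (collapse A)
collapse-sound (ME1 d)      = mp (◇-intro (□ _)) (M3 (collapse-sound d))
collapse-sound (ME2 A B)    = ◇□-mp (collapse A) (collapse B)

module HMR {A : Fm} (modalFree : ModalFree A) where

  ∀-¬◇□¬⊃∀ : ⊢ ∀' (¬' (◇ (□ (¬' A)))) ⊃ ∀' A
  ∀-¬◇□¬⊃∀ = ∀-mono (⊃-trans (¬◇□¬⊃◇ A) (M5 A modalFree))

  ∀-◇□⊃∀ : ⊢ ◇ (∀' (◇ (□ A))) ⊃ ∀' A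
  ∀-◇□⊃∀ = ⊃-trans (◇-mono (∀-mono (⊃-trans (◇□⊃□ A) (M1 A)))) (M5 (∀' A) modalFree)

  collapse-A : collapse A ≡ A
  collapse-A = collapse-modalFree modalFree

  Nt : ⊢ ◇ (P (∀' (¬' (◇ (P (¬' A)))))) → ⊢ ◇ (P (∀' A))
  Nt h = ME1 (mp ∀-¬◇□¬⊃∀ (mp (M1 _) (mp (◇□⊃□ _) h′)))
    where
    h′ : ⊢ ◇ (□ (∀' (¬' (◇ (□ (¬' A))))))
    h′ = subst (λ X → ⊢ ◇ (□ (∀' (¬' (◇ (□ (¬' X))))))) collapse-A (collapse-sound h)

  W1 : ⊢ ◇ (∀' (◇ (P A))) → ⊢ ◇ (P (∀' A))
  W1 h = ME1 (mp ∀-◇□⊃∀ h′)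
    where
    h′ : ⊢ ◇ (∀' (◇ (□ A)))
    h′ = subst (λ X → ⊢ ◇ (∀' (◇ (□ X)))) collapse-A (collapse-sound h)

  W2 : ⊢ □ (∀' (¬' (◇ (P (¬' A))))) → ⊢ □ (∀' A)
  W2 h = M3 (mp ∀-¬◇□¬⊃∀ (mp (M1 _) h′))
    where
    h′ : ⊢ □ (∀' (¬' (◇ (□ (¬' A)))))
    h′ = subst (λ X → ⊢ □ (∀' (¬' (◇ (□ (¬' X)))))) collapse-A (collapse-sound h)

  W3 : ⊢ □ (∀' (◇ A)) → ⊢ □ (∀' A)
  W3 h = M3 (mp (∀-mono (M5 A modalFree)) (mp (M1 _) h))

theorem7p1 : (f : PR 2) →
    (⊢ ◇ (P (∀' (¬' (◇ (P (¬' (∃' (R f)))))))) → ⊢ ◇ (P (∀' (∃' (R f)))))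
    × (⊢ ◇ (∀' (◇ (P (∃' (R f))))) → ⊢ ◇ (P (∀' (∃' (R f)))))
    × (⊢ □ (∀' (¬' (◇ (P (¬' (∃' (R f))))))) → ⊢ □ (∀' (∃' (R f))))
    × (⊢ □ (∀' (◇ (∃' (R f)))) → ⊢ □ (∀' (∃' (R f))))
theorem7p1 f = Nt , W1 , W2 , W3
  where open HMR {∃' (R f)} ((tt , tt) , tt)
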